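{- Let $\alpha\ge-1$ be a real number and $P=(p_{ij})_{i,j\ge0}$ the matrix over $\mathbb R[x]$ with $p_{n,n+1}=1$, $p_{n,n}=2n+1+\alpha+x$, $p_{n,n-1}=n(n+\alpha)+2nx$, $p_{n,n-2}=n(n-1)x$, and all other entries $0$. Suppose there exist polynomials $\alpha_2,\alpha_3,\dots\in\mathbb R[x]$ such that $P=P^{(2;0)}(\boldsymbol\alpha)$, where, with the conventions $\alpha_0=\alpha_1=0$, $P^{(2;0)}(\boldsymbol\alpha)$ has entries $P_{n,n+1}=1$, $P_{n,n}=\alpha_{3n}+\alpha_{3n+1}+\alpha_{3n+2}$, $P_{n,n-1}=\alpha_{3n-2}\alpha_{3n}+\alpha_{3n-1}\alpha_{3n}+\alpha_{3n-1}\alpha_{3n+1}$, $P_{n,n-2}=\alpha_{3n-4}\alpha_{3n-2}\alpha_{3n}$, and all other entries $0$. Then $\alpha=-1$.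
   Context: $P^{(2;0)}(\boldsymbol\alpha)$ is the production matrix of the generalized $2$-Stieltjes–Rogers polynomials of type $0$ with weights $\boldsymbol\alpha$; its entries are as given explicitly in the claim. -}

module Defs where

open import Level using (0ℓ)
open import Data.Nat using (ℕ; zero; suc; _≡ᵇ_; _<_; _∸_)
  renaming (_+_ to _+ℕ_; _*_ to _*ℕ_)
open import Data.Bool using (if_then_else_)
open import Data.Product using (Σ; ∃; _×_; _,_)
open import Relation.Nullary using (¬_)
open import Relation.Binary.Structures using (IsTotalOrder)
open import Algebra.Bundles using (CommutativeRing)

-- The real numbers, axiomatised as a complete (Dedekind-complete) ordered
-- field.  Classically every such structure is isomorphic to ℝ.
record CompleteOrderedField : Set₁ where
  field
    commRing : CommutativeRing 0ℓ 0ℓ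
  open CommutativeRing commRing public
  infix 4 _≤_
  field
    _≤_          : Carrier → Carrier → Set
    isTotalOrder : IsTotalOrder _≈_ _≤_
    0≉1          : ¬ (0# ≈ 1#)
    inverse      : ∀ x → ¬ (x ≈ 0#) → ∃ λ y → x * y ≈ 1#
    +-mono-≤     : ∀ {x y} z → x ≤ y → x + z ≤ y + z
    *-nonneg     : ∀ {x y} → 0# ≤ x → 0# ≤ y → 0# ≤ x * y
    complete     : (S : Carrier → Set) → (∃ λ x → S x) →
                   (∃ λ b → ∀ x → S x → x ≤ b) →
                   ∃ λ s → (∀ x → S x → x ≤ s) ×
                           (∀ b → (∀ x → S x → x ≤ b) → s ≤ b)

module Poly (R : CompleteOrderedField) where
  open CompleteOrderedField R

  -- Elements of R[x] are represented by their coefficient sequences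
  -- (inside the formal power series ring R[[x]], into which R[x] embeds
  -- injectively as a subring).
  Series : Set
  Series = ℕ → Carrier

  IsPoly : Series → Set
  IsPoly p = ∃ λ d → ∀ k → d < k → p k ≈ 0#

  infix 4 _≋_
  _≋_ : Series → Series → Set
  p ≋ q = ∀ k → p k ≈ q k

  ℕ→R : ℕ → Carrier
  ℕ→R zero    = 0#
  ℕ→R (suc n) = 1# + ℕ→R n

  const : Carrier → Series
  const c k = if k ≡ᵇ 0 then c else 0#

  0ₚ 1ₚ X : Series
  0ₚ = const 0#
  1ₚ = const 1#
  X k = if k ≡ᵇ 1 then 1# else 0#

  _+ₚ_ : Series → Series → Series
  (p +ₚ q) k = p k + q k

  sumTo : ℕ → (ℕ → Carrier) → Carrier
  sumTo zero    f = f 0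
  sumTo (suc n) f = sumTo n f + f (suc n)

  _*ₚ_ : Series → Series → Series
  (p *ₚ q) k = sumTo k (λ i → p i * q (k ∸ i))

  infixl 6 _+ₚ_
  infixl 7 _*ₚ_

  band : (d₀ d₁ d₂ : ℕ → Series) → ℕ → ℕ → Series
  band d₀ d₁ d₂ i j =
    if j ≡ᵇ suc i then 1ₚ
    else if j ≡ᵇ i then d₀ i
    else if i ≡ᵇ suc j then d₁ i
    else if i ≡ᵇ suc (suc j) then d₂ i
    else 0ₚ

  Pmat : Carrier → ℕ → ℕ → Series
  Pmat a = band
    (λ n → const (ℕ→R (2 *ℕ n +ℕ 1) + a) +ₚ X)
    (λ n → const (ℕ→R n * (ℕ→R n + a)) +ₚ const (ℕ→R (2 *ℕ n)) *ₚ X)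
    (λ n → const (ℕ→R (n *ℕ (n ∸ 1))) *ₚ X)

  -- weights with the convention α₀ = α₁ = 0 (the given α 0, α 1 are ignored)
  wt : (ℕ → Series) → ℕ → Series
  wt α 0 = 0ₚ
  wt α 1 = 0ₚ
  wt α (suc (suc k)) = α (suc (suc k))

  -- production matrix P^{(2;0)}(α) of the generalized 2-Stieltjes–Rogers
  -- polynomials of type 0.  (Subdiagonal entries are only used for n ≥ 1,
  -- resp. n ≥ 2, so truncated subtraction is harmless.)
  P20 : (ℕ → Series) → ℕ → ℕ → Series
  P20 α = band
    (λ n → w (3 *ℕ n) +ₚ w (3 *ℕ n +ℕ 1) +ₚ w (3 *ℕ n +ℕ 2))
    (λ n → w (3 *ℕ n ∸ 2) *ₚ w (3 *ℕ n)
         +ₚ w (3 *ℕ n ∸ 1) *ₚ w (3 *ℕ n)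
         +ₚ w (3 *ℕ n ∸ 1) *ₚ w (3 *ℕ n +ℕ 1))
    (λ n → w (3 *ℕ n ∸ 4) *ₚ w (3 *ℕ n ∸ 2) *ₚ w (3 *ℕ n))
    where w = wt α

-- Since α₀ = α₁ = 0, the entries P_{0,0} and P_{1,0} give α₂ = c + x and
-- α₂ (α₃ + α₄) = c + 2x with c = 1 + α.  A linear polynomial multiple of c + x
-- is a constant multiple of it, so α₃ + α₄ = 2 and 2c = c, i.e. c = 0.
module Submission where

open import Defs
open import Data.Nat using (ℕ; _≤_; zero; suc; s≤s; z≤n) renaming (_+_ to _+ℕ_)
open import Data.Nat.Properties using (m≤m+n; m≤n+m; +-suc; ≤-trans; ≤-reflexive)
  renaming (+-identityʳ to +ℕ-identityʳ)
open import Data.Product using (_,_)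
import Algebra.Properties.Group as GroupProperties
import Algebra.Properties.CommutativeSemigroup as CommutativeSemigroupProperties
import Relation.Binary.Reasoning.Setoid as SetoidReasoning

module PolySeries (R : CompleteOrderedField) where
  open CompleteOrderedField R hiding (_≤_)
  open Poly R
  open SetoidReasoning setoid
  open GroupProperties +-group using (inverseʳ-unique; ∙-cancelˡ)
  open CommutativeSemigroupProperties +-commutativeSemigroup using (interchange)

  record IsLinear (p q : Carrier) (h : Series) : Set where
    field
      coeff₀  : h 0 ≈ p
      coeff₁  : h 1 ≈ q
      coeff≥2 : ∀ k → h (suc (suc k)) ≈ 0#
  open IsLinear

  IsLinear-cong : ∀ {p p′ q q′ h h′} → p ≈ p′ → q ≈ q′ → h ≋ h′ →
                  IsLinear p q h → IsLinear p′ q′ h′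
  IsLinear-cong p≈p′ q≈q′ h≋h′ lin = record
    { coeff₀  = trans (sym (h≋h′ 0)) (trans (coeff₀ lin) p≈p′)
    ; coeff₁  = trans (sym (h≋h′ 1)) (trans (coeff₁ lin) q≈q′)
    ; coeff≥2 = λ k → trans (sym (h≋h′ (suc (suc k)))) (coeff≥2 lin k)
    }

  0ₚ≈0 : ∀ k → 0ₚ k ≈ 0#
  0ₚ≈0 zero    = refl
  0ₚ≈0 (suc k) = refl

  const-linear : ∀ c → IsLinear c 0# (const c)
  const-linear c = record { coeff₀ = refl ; coeff₁ = refl ; coeff≥2 = λ _ → refl }

  X-linear : IsLinear 0# 1# X
  X-linear = record { coeff₀ = refl ; coeff₁ = refl ; coeff≥2 = λ _ → refl }

  +ₚ-linear : ∀ {p q p′ q′ f g} → IsLinear p q f → IsLinear p′ q′ g →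
              IsLinear (p + p′) (q + q′) (f +ₚ g)
  +ₚ-linear f-lin g-lin = record
    { coeff₀  = +-cong (coeff₀ f-lin) (coeff₀ g-lin)
    ; coeff₁  = +-cong (coeff₁ f-lin) (coeff₁ g-lin)
    ; coeff≥2 = λ k → trans (+-cong (coeff≥2 f-lin k) (coeff≥2 g-lin k)) (+-identityʳ 0#)
    }

  sumTo-cong : ∀ n {f g : ℕ → Carrier} → (∀ i → f i ≈ g i) → sumTo n f ≈ sumTo n g
  sumTo-cong zero    f≈g = f≈g 0
  sumTo-cong (suc n) f≈g = +-cong (sumTo-cong n f≈g) (f≈g (suc n))

  sumTo-zero : ∀ n {f : ℕ → Carrier} → (∀ i → f i ≈ 0#) → sumTo n f ≈ 0#
  sumTo-zero zero    f≈0 = f≈0 0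
  sumTo-zero (suc n) f≈0 = trans (+-cong (sumTo-zero n f≈0) (f≈0 (suc n))) (+-identityʳ 0#)

  sumTo-+ : ∀ n (f g : ℕ → Carrier) →
            sumTo n (λ i → f i + g i) ≈ sumTo n f + sumTo n g
  sumTo-+ zero    f g = refl
  sumTo-+ (suc n) f g = trans (+-cong (sumTo-+ n f g) refl) (interchange _ _ _ _)

  sumTo-first-two : ∀ n {f : ℕ → Carrier} → (∀ i → f (suc (suc i)) ≈ 0#) →
                    sumTo (suc n) f ≈ f 0 + f 1
  sumTo-first-two zero    f≈0 = refl
  sumTo-first-two (suc n) f≈0 =
    trans (+-cong (sumTo-first-two n f≈0) (f≈0 n)) (+-identityʳ _)

  0ₚ-*ₚ : ∀ f → 0ₚ *ₚ f ≋ 0ₚ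
  0ₚ-*ₚ f k = trans (sumTo-zero k (λ i → trans (*-congʳ (0ₚ≈0 i)) (zeroˡ _))) (sym (0ₚ≈0 k))

  *ₚ-distribˡ-+ₚ : ∀ f g h → f *ₚ (g +ₚ h) ≋ f *ₚ g +ₚ f *ₚ h
  *ₚ-distribˡ-+ₚ f g h k =
    trans (sumTo-cong k (λ i → distribˡ (f i) _ _)) (sumTo-+ k _ _)

  linear-*ₚ-zero : ∀ {p q g} → IsLinear p q g → ∀ f → (g *ₚ f) 0 ≈ p * f 0
  linear-*ₚ-zero g-lin f = *-congʳ (coeff₀ g-lin)

  linear-*ₚ-suc : ∀ {p q g} → IsLinear p q g → ∀ f m →
                  (g *ₚ f) (suc m) ≈ p * f (suc m) + q * f m
  linear-*ₚ-suc {p} {q} {g} g-lin f m = begin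
    (g *ₚ f) (suc m)                   ≈⟨ sumTo-first-two m (λ i → trans (*-congʳ (coeff≥2 g-lin i)) (zeroˡ _)) ⟩
    g 0 * f (suc m) + g 1 * f m        ≈⟨ +-cong (*-congʳ (coeff₀ g-lin)) (*-congʳ (coeff₁ g-lin)) ⟩
    p * f (suc m) + q * f m            ∎

  const-*ₚ-linear : ∀ c {p q f} → IsLinear p q f → IsLinear (c * p) (c * q) (const c *ₚ f)
  const-*ₚ-linear c {f = f} f-lin = record
    { coeff₀  = *-congˡ (coeff₀ f-lin)
    ; coeff₁  = trans (linear-*ₚ-suc (const-linear c) f 0)
                      (trans (+-cong (*-congˡ (coeff₁ f-lin)) (zeroˡ _)) (+-identityʳ _))
    ; coeff≥2 = λ k → trans (linear-*ₚ-suc (const-linear c) f (suc k))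
                      (trans (+-cong (trans (*-congˡ (coeff≥2 f-lin k)) (zeroʳ c)) (zeroˡ _))
                             (+-identityʳ 0#))
    }

  IsPoly-+ₚ : ∀ {f g} → IsPoly f → IsPoly g → IsPoly (f +ₚ g)
  IsPoly-+ₚ {f} {g} (d , f-vanishes) (e , g-vanishes) = d +ℕ e , λ k d+e<k →
    trans (+-cong (f-vanishes k (≤-trans (s≤s (m≤m+n d e)) d+e<k))
                  (g-vanishes k (≤-trans (s≤s (m≤n+m e d)) d+e<k)))
          (+-identityʳ 0#)

  -- Downward induction from the degree bound: β_{m+1} = - c β_{m+2}.
  recurrence-tail-zero : ∀ c {β} → IsPoly β →
                         (∀ m → c * β (suc (suc m)) + β (suc m) ≈ 0#) →
                         ∀ m → β (suc m) ≈ 0#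
  recurrence-tail-zero c {β} (d , β-vanishes) rec m = below d m (m≤n+m d m)
    where
      below : ∀ t m → d ≤ m +ℕ t → β (suc m) ≈ 0#
      below zero    m d≤m+0 = β-vanishes (suc m) (s≤s (≤-trans d≤m+0 (≤-reflexive (+ℕ-identityʳ m))))
      below (suc t) m d≤m+1+t = begin
        β (suc m)                          ≈⟨ sym (+-identityˡ _) ⟩
        0# + β (suc m)                     ≈⟨ +-cong (sym (trans (*-congˡ next) (zeroʳ c))) refl ⟩
        c * β (suc (suc m)) + β (suc m)    ≈⟨ rec m ⟩
        0#                                 ∎
        where next = below t (suc m) (≤-trans d≤m+1+t (≤-reflexive (+-suc m t)))

  linear-multiple : ∀ {c p q g β} → IsLinear c 1# g → IsPoly β →
                    IsLinear p q (g *ₚ β) → c * q ≈ p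
  linear-multiple {c} {p} {q} {g} {β} g-lin β-poly prod-lin = begin
    c * q                  ≈⟨ *-congˡ β₀≈q ⟩
    c * β 0                ≈⟨ sym (linear-*ₚ-zero g-lin β) ⟩
    (g *ₚ β) 0             ≈⟨ coeff₀ prod-lin ⟩
    p                      ∎
    where
      coeff-suc : ∀ m → (g *ₚ β) (suc m) ≈ c * β (suc m) + β m
      coeff-suc m = trans (linear-*ₚ-suc g-lin β m) (+-cong refl (*-identityˡ _))

      β-tail : ∀ m → β (suc m) ≈ 0#
      β-tail = recurrence-tail-zero c β-poly
                 (λ m → trans (sym (coeff-suc (suc m))) (coeff≥2 prod-lin m))

      β₀≈q : q ≈ β 0
      β₀≈q = begin
        q                  ≈⟨ sym (coeff₁ prod-lin) ⟩
        (g *ₚ β) 1         ≈⟨ coeff-suc 0 ⟩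
        c * β 1 + β 0      ≈⟨ +-cong (trans (*-congˡ (β-tail 0)) (zeroʳ c)) refl ⟩
        0# + β 0           ≈⟨ +-identityˡ _ ⟩
        β 0                ∎

  fixed-by-two : ∀ {c} → c * (1# + 1#) ≈ c → c ≈ 0#
  fixed-by-two {c} c2≈c = ∙-cancelˡ c c 0# (begin
    c + c                  ≈⟨ sym (trans (distribˡ c 1# 1#) (+-cong (*-identityʳ c) (*-identityʳ c))) ⟩
    c * (1# + 1#)          ≈⟨ c2≈c ⟩
    c                      ≈⟨ sym (+-identityʳ c) ⟩
    c + 0#                 ∎)

  1+a≈0⇒a≈-1 : ∀ {a} → 1# + a ≈ 0# → a ≈ - 1#
  1+a≈0⇒a≈-1 {a} = inverseʳ-unique 1# a

  Pmat₀₀-linear : ∀ a → IsLinear (1# + a) 1# (Pmat a 0 0)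
  Pmat₀₀-linear a = IsLinear-cong
    (trans (+-identityʳ _) (+-cong (+-identityʳ 1#) refl))
    (+-identityˡ 1#)
    (λ _ → refl)
    (+ₚ-linear (const-linear _) X-linear)

  Pmat₁₀-linear : ∀ a → IsLinear (1# + a) (1# + 1#) (Pmat a 1 0)
  Pmat₁₀-linear a = IsLinear-cong
    (trans (+-cong (*-cong (+-identityʳ 1#) (+-cong (+-identityʳ 1#) refl)) (zeroʳ _))
           (trans (+-identityʳ _) (*-identityˡ _)))
    (trans (+-identityˡ _) (trans (*-identityʳ _) (+-cong refl (+-identityʳ 1#))))
    (λ _ → refl)
    (+ₚ-linear (const-linear _) (const-*ₚ-linear _ X-linear))

  P20₀₀ : ∀ α → P20 α 0 0 ≋ α 2
  P20₀₀ α k = trans (+-cong (trans (+-cong (0ₚ≈0 k) (0ₚ≈0 k)) (+-identityʳ 0#)) refl)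
                    (+-identityˡ _)

  P20₁₀ : ∀ α → P20 α 1 0 ≋ α 2 *ₚ (α 3 +ₚ α 4)
  P20₁₀ α k = begin
    (0ₚ *ₚ α 3) k + (α 2 *ₚ α 3) k + (α 2 *ₚ α 4) k
      ≈⟨ +-cong (trans (+-cong (trans (0ₚ-*ₚ (α 3) k) (0ₚ≈0 k)) refl) (+-identityˡ _)) refl ⟩
    (α 2 *ₚ α 3) k + (α 2 *ₚ α 4) k
      ≈⟨ sym (*ₚ-distribˡ-+ₚ (α 2) (α 3) (α 4) k) ⟩
    (α 2 *ₚ (α 3 +ₚ α 4)) k ∎


open CompleteOrderedField using (Carrier; _≈_; 1#; -_)
open Poly using (Series; IsPoly; _≋_; Pmat; P20)

propositionA7 : (R : CompleteOrderedField) →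
    (a : Carrier R) → CompleteOrderedField._≤_ R (-_ R (1# R)) a →
    (α : ℕ → Series R) → (∀ k → 2 ≤ k → IsPoly R (α k)) →
    (∀ i j → _≋_ R (Pmat R a i j) (P20 R α i j)) →
    _≈_ R a (-_ R (1# R))
propositionA7 R a _ α poly P≋P20 =
  1+a≈0⇒a≈-1 (fixed-by-two (linear-multiple α₂-linear β-poly product-linear))
  where
    open PolySeries R
    open CompleteOrderedField R using (refl; trans; _+_)
    open Poly R using (_+ₚ_; _*ₚ_)

    α₂-linear : IsLinear (1# R + a) (1# R) (α 2)
    α₂-linear = IsLinear-cong refl refl (λ k → trans (P≋P20 0 0 k) (P20₀₀ α k)) (Pmat₀₀-linear a)

    product-linear : IsLinear (1# R + a) (1# R + 1# R) (α 2 *ₚ (α 3 +ₚ α 4))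
    product-linear = IsLinear-cong refl refl (λ k → trans (P≋P20 1 0 k) (P20₁₀ α k)) (Pmat₁₀-linear a)

    β-poly : IsPoly R (α 3 +ₚ α 4)
    β-poly = IsPoly-+ₚ (poly 3 (s≤s (s≤s z≤n))) (poly 4 (s≤s (s≤s z≤n)))
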